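{- Let $G$ be a graph, $M=M[IAS(G)]$, and $X\subseteq V(G)$. Then the following are equivalent. \begin{enumerate} \item The rank of $\tau_G(X)$ in $M$ is $\ge 2|X|$. \item The rank of $\tau_G(X)$ in $M$ equals $2|X|$. \item No transverse circuit of $M$ is contained in $\tau_G(X)$. \end{enumerate}
   Context: A graph is a finite looped simple graph; $A(G)$ is its $GF(2)$ adjacency matrix (diagonal 1 iff looped). $M[IAS(G)]$ is the binary matroid represented by $(I\;A(G)\;A(G)+I)$, with elements $\phi_G(v),\chi_G(v),\psi_G(v)$ (the $v$ columns of $I,A(G),A(G)+I$); $\tau_G(v)=\{\phi_G(v),\chi_G(v),\psi_G(v)\}$, $\tau_G(X)=\bigcup_{x\in X}\tau_G(x)$. A transversal is a subset of the ground set meeting every vertex triple exactly once; a transverse circuit is a circuit of $M$ contained in some transversal. -}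

module Defs where

open import Data.Bool using (Bool; true; false; _xor_; _∧_; not; if_then_else_)
open import Data.Nat using (ℕ; zero; suc; _⊔_)
open import Data.Fin using (Fin)
open import Data.Fin.Subset using (Subset; _∈_; _∉_)
open import Data.Product using (_×_; _,_; proj₁; proj₂; Σ; ∃-syntax)
open import Data.List using (List; []; _∷_; map; _++_; foldr; length; filter; allFin; cartesianProduct; null)
open import Data.List.Relation.Binary.Sublist.Propositional using (_⊆_)
open import Relation.Binary.PropositionalEquality using (_≡_)
open import Relation.Nullary using (¬_)

-- A looped simple graph on vertex set Fin n is given by its GF(2) adjacency
-- matrix A (A i j = true iff i,j adjacent; A i i = true iff i looped),
-- which must be symmetric.
record Graph (n : ℕ) : Set where
  field
    adj : Fin n → Fin n → Bool
    sym : ∀ i j → adj i j ≡ adj j i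
open Graph public

eqᵇ : ∀ {n} → Fin n → Fin n → Bool
eqᵇ Fin.zero Fin.zero = true
eqᵇ Fin.zero (Fin.suc _) = false
eqᵇ (Fin.suc _) Fin.zero = false
eqᵇ (Fin.suc i) (Fin.suc j) = eqᵇ i j

-- Ground set of M[IAS(G)]: pairs (v , k) with k = 0 ↦ φ_G(v), 1 ↦ χ_G(v), 2 ↦ ψ_G(v).
Elem : ℕ → Set
Elem n = Fin n × Fin 3

φ χ ψ : ∀ {n} → Fin n → Elem n
φ v = v , Fin.zero
χ v = v , Fin.suc Fin.zero
ψ v = v , Fin.suc (Fin.suc Fin.zero)

-- The column of the matrix (I  A(G)  A(G)+I) representing an element.
column : ∀ {n} → Graph n → Elem n → Fin n → Bool
column G (v , Fin.zero) i = eqᵇ i v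
column G (v , Fin.suc Fin.zero) i = adj G i v
column G (v , Fin.suc (Fin.suc Fin.zero)) i = adj G i v xor eqᵇ i v

allElems : ∀ n → List (Elem n)
allElems n = cartesianProduct (allFin n) (allFin 3)

allᵇ : ∀ {A : Set} → (A → Bool) → List A → Bool
allᵇ p [] = true
allᵇ p (x ∷ xs) = p x ∧ allᵇ p xs

colSum : ∀ {n} → Graph n → List (Elem n) → Fin n → Bool
colSum G [] i = false
colSum G (e ∷ es) i = column G e i xor colSum G es i

isZeroᵇ : ∀ {n} → (Fin n → Bool) → Bool
isZeroᵇ {n} w = allᵇ (λ i → not (w i)) (allFin n)

sublists : ∀ {A : Set} → List A → List (List A)
sublists [] = [] ∷ []
sublists (x ∷ xs) = let r = sublists xs in map (x ∷_) r ++ r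

-- Subsets of the ground set are represented by sublists of allElems
-- (duplicate-free).
independentᵇ : ∀ {n} → Graph n → List (Elem n) → Bool
independentᵇ G L = allᵇ (λ L' → null L' Data.Bool.∨ not (isZeroᵇ (colSum G L'))) (sublists L)

ESet : ℕ → Set
ESet n = Elem n → Bool

maximum : List ℕ → ℕ
maximum = foldr _⊔_ 0

rank : ∀ {n} → Graph n → ESet n → ℕ
rank {n} G S =
  maximum (map length (filter (λ T → Data.Bool.T? (allᵇ S T ∧ independentᵇ G T)) (sublists (allElems n))))

τ : ∀ {n} → Subset n → ESet n
τ X (v , k) = Data.Vec.lookup X v
  where import Data.Vec

Dependent : ∀ {n} → Graph n → List (Elem n) → Set
Dependent G C = independentᵇ G C ≡ false

IsCircuit : ∀ {n} → Graph n → List (Elem n) → Set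
IsCircuit {n} G C =
  C ⊆ allElems n × Dependent G C ×
  (∀ C' → C' ⊆ C → ¬ (length C' ≡ length C) → independentᵇ G C' ≡ true)

-- A transversal: meets every vertex triple exactly once, i.e. it is
-- {(v , t v) | v} for a choice function t.
transversal : ∀ {n} → (Fin n → Fin 3) → ESet n
transversal t (v , k) = eqᵇ (t v) k

_⊆ₛ_ : ∀ {n} → List (Elem n) → ESet n → Set
L ⊆ₛ S = allᵇ S L ≡ true

IsTransverseCircuit : ∀ {n} → Graph n → List (Elem n) → Set
IsTransverseCircuit G C = IsCircuit G C × ∃[ t ] (C ⊆ₛ transversal t)

module Submission where

-- Lemma 3.4.  Let W = {φ(v), χ(v) : v ∈ X}.  As col ψ(v) = col φ(v) + col χ(v),
-- W spans every column of τ(X), so by the Steinitz exchange lemma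
-- rank τ(X) ≤ |W| = 2|X|; this gives (1) ⇔ (2).  For (2) ⇔ (3):
--  * if W is dependent, merge a nonempty zero-sum subset of W vertex by vertex
--    (φ(v) and χ(v) together become ψ(v)).  The result is a zero-sum subset of
--    τ(X) meeting each vertex at most once, so it lies in a transversal, and a
--    circuit inside it is a transverse circuit.  Hence without transverse
--    circuits W is independent and rank τ(X) = 2|X|;
--  * a transverse circuit in τ(X) contains a nonempty zero-sum subset c₀ ∷ Q
--    meeting each vertex at most once.  Then col c₀ = Σ col Q is spanned by
--    the elements of W over the other vertices, which makes one element of W
--    over the vertex of c₀ redundant: rank τ(X) < 2|X|.

open import Defs hiding (sym)
open import Data.Nat using (ℕ; zero; suc; _≤_; _*_; z≤n; s≤s)
open import Data.Fin.Subset using (Subset; ∣_∣)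
open import Data.List
  using (List; []; _∷_; _++_; map; length; lookup; null; filter; allFin; tabulate; cartesianProduct)
open import Relation.Binary.PropositionalEquality
  using (_≡_; _≢_; refl; sym; trans; cong; cong₂; subst; module ≡-Reasoning)
open import Relation.Nullary using (¬_; Dec; yes; no; ¬?; _×-dec_)
open import Data.Product using (Σ; ∃-syntax; _×_; _,_; proj₁; proj₂)
open import Function.Bundles using (Equivalence; _⇔_; mk⇔)

import Data.Bool as Bool
open import Data.Bool using (Bool; true; false; _xor_; _∧_; not; if_then_else_)
open import Data.Bool.Properties
  using (xor-∧-commutativeRing; xor-identityʳ; ∧-zeroʳ; ∨-identityʳ; T-∧; T-≡)
open import Data.Empty using (⊥-elim)
import Data.Fin as Fin
open import Data.Fin using (Fin; zero; suc)
open import Data.Fin.Properties using (suc-injective; 0≢1+n)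
open import Data.List.Properties using (length-++-sucʳ)
open import Data.List.Membership.Propositional using (_∈_; lose; find)
open import Data.List.Membership.Propositional.Properties
  using ( ∈-++⁺ˡ; ∈-++⁺ʳ; ∈-++⁻; ∈-∃++; ∈-map⁺; ∈-map⁻; ∈-cartesianProduct⁻; ∈-tabulate⁻
        ; ∈-allFin; ∈-lookup; ∈-filter⁺; ∈-filter⁻)
open import Data.List.Relation.Binary.Sublist.Propositional
  using (_⊆_; []; _∷_; _∷ʳ_; ⊆-refl; ⊆-trans)
open import Data.List.Relation.Binary.Sublist.Propositional.Properties
  using (All-resp-⊆; Any-resp-⊆; length-mono-≤)
open import Data.List.Relation.Unary.All as All using (All; []; _∷_)
open import Data.List.Relation.Unary.AllPairs using (AllPairs; []; _∷_)
open import Data.List.Relation.Unary.Any using (here; there; index; any?)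
open import Data.List.Relation.Unary.Any.Properties using (lookup-index)
open import Data.List.Relation.Unary.Unique.Propositional using (Unique)
open import Data.List.Relation.Unary.Unique.Propositional.Properties
  using (cartesianProduct⁺; allFin⁺)
open import Data.Maybe using (Maybe; just; nothing)
import Data.Nat as ℕ
open import Data.Nat.Properties
  using ( module ≤-Reasoning; ≤-refl; ≤-trans; ≤-antisym; ≤-reflexive; <-irrefl; ≤∧≢⇒<; *-suc
        ; m≤m⊔n; m≤n⊔m; ⊔-lub)
open import Data.Product.Properties using (≡-dec)
open import Data.Sum using (inj₁; inj₂)
import Data.Vec as Vec
open import Data.Vec.Functional using (Vector; head; tail; removeAt) renaming (_∷_ to _∷ᵛ_)
open import Function using (_∘_; id)
open import Function.Definitions using (Injective)
open import Tactic.RingSolver using (solve-∀)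
open import Tactic.RingSolver.Core.AlmostCommutativeRing
  using (AlmostCommutativeRing; fromCommutativeRing)

-- GF(2) = (Bool, xor, ∧) as a ring, so that the ring solver can discharge
-- the Boolean identities behind the linear-algebra lemmas below.
𝔽₂ : AlmostCommutativeRing _ _
𝔽₂ = fromCommutativeRing xor-∧-commutativeRing isFalse
  where
    isFalse : (b : Bool) → Maybe (false ≡ b)
    isFalse false = just refl
    isFalse true  = nothing

Word : ℕ → Set
Word n = Vector Bool n

module _ {n : ℕ} where

  infix 4 _≈_
  infixl 6 _⊕_
  infixr 7 _·_

  _≈_ : Word n → Word n → Set
  v ≈ w = ∀ i → v i ≡ w i

  𝟎 : Word n
  𝟎 _ = false

  _⊕_ : Word n → Word n → Word n
  (v ⊕ w) i = v i xor w i

  _·_ : Bool → Word n → Word n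
  (b · v) i = b ∧ v i

module _ {n : ℕ} where

  combine : ∀ {k} → Vector (Word n) k → Word k → Word n
  combine {zero}  S c = 𝟎
  combine {suc k} S c = head c · head S ⊕ combine (tail S) (tail c)

  Spans : ∀ {k} → Vector (Word n) k → Word n → Set
  Spans {k} S v = Σ (Word k) λ c → combine S c ≈ v

  Independent : ∀ {k} → Vector (Word n) k → Set
  Independent {k} S = ∀ (c : Word k) → combine S c ≈ 𝟎 → c ≈ 𝟎

  combine-cong : ∀ {k} (S : Vector (Word n) k) {c d : Word k} → c ≈ d →
    combine S c ≈ combine S d
  combine-cong {zero}  S c≈d i = refl
  combine-cong {suc k} S c≈d i =
    cong₂ (λ a r → (a ∧ head S i) xor r) (c≈d zero) (combine-cong (tail S) (c≈d ∘ suc) i)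

  combine-𝟎 : ∀ {k} (S : Vector (Word n) k) → combine S 𝟎 ≈ 𝟎
  combine-𝟎 {zero}  S i = refl
  combine-𝟎 {suc k} S i = combine-𝟎 (tail S) i

  combine-⊕ : ∀ {k} (S : Vector (Word n) k) (c d : Word k) →
    combine S (c ⊕ d) ≈ combine S c ⊕ combine S d
  combine-⊕ {zero}  S c d i = refl
  combine-⊕ {suc k} S c d i =
    trans (cong (((head c xor head d) ∧ head S i) xor_)
                (combine-⊕ (tail S) (tail c) (tail d) i))
          (distrib (head c) (head d) (head S i) _ _)
    where
      distrib : ∀ a b s x y →
        ((a xor b) ∧ s) xor (x xor y) ≡ ((a ∧ s) xor x) xor ((b ∧ s) xor y)
      distrib = solve-∀ 𝔽₂

  combine-· : ∀ {k} (S : Vector (Word n) k) b (c : Word k) →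
    combine S (b · c) ≈ b · combine S c
  combine-· {zero}  S b c i = sym (∧-zeroʳ b)
  combine-· {suc k} S b c i =
    trans (cong (((b ∧ head c) ∧ head S i) xor_) (combine-· (tail S) b (tail c) i))
          (distrib b (head c) (head S i) _)
    where
      distrib : ∀ b a s x → ((b ∧ a) ∧ s) xor (b ∧ x) ≡ b ∧ ((a ∧ s) xor x)
      distrib = solve-∀ 𝔽₂

  combine-removeAt : ∀ {k} (S : Vector (Word n) (suc k)) (c : Word (suc k)) j → c j ≡ false →
    combine S c ≈ combine (removeAt S j) (removeAt c j)
  combine-removeAt          S c zero    c₀≡false i rewrite c₀≡false = refl
  combine-removeAt {suc k}  S c (suc j) cⱼ≡false i =
    cong ((head c ∧ head S i) xor_) (combine-removeAt (tail S) (tail c) j cⱼ≡false i)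

  dot : ∀ {k} → Word k → Word k → Bool
  dot {zero}  μ b = false
  dot {suc k} μ b = (head μ ∧ head b) xor dot (tail μ) (tail b)

  combine-shear : ∀ {k} (T : Vector (Word n) k) (b : Word k) (t : Word n) (μ : Word k) →
    combine (λ i → T i ⊕ b i · t) μ ≈ combine (t ∷ᵛ T) (dot μ b ∷ᵛ μ)
  combine-shear {zero}  T b t μ i = refl
  combine-shear {suc k} T b t μ i =
    trans (cong ((head μ ∧ (head T i xor (head b ∧ t i))) xor_)
                (combine-shear (tail T) (tail b) t (tail μ) i))
          (regroup (head μ) (head T i) (head b) (t i) (dot (tail μ) (tail b)) _)
    where
      regroup : ∀ m x b t d r →
        (m ∧ (x xor (b ∧ t))) xor ((d ∧ t) xor r) ≡ (((m ∧ b) xor d) ∧ t) xor ((m ∧ x) xor r)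
      regroup = solve-∀ 𝔽₂

  nonzero-entry : ∀ {k} (c : Word k) → ¬ c ≈ 𝟎 → ∃[ j ] c j ≡ true
  nonzero-entry {zero}  c c≉𝟎 = ⊥-elim (c≉𝟎 λ ())
  nonzero-entry {suc k} c c≉𝟎 with head c in c₀
  ... | true  = zero , c₀
  ... | false =
    let j , cⱼ = nonzero-entry (tail c) (λ c′≈𝟎 → c≉𝟎 λ { zero → c₀ ; (suc i) → c′≈𝟎 i })
    in suc j , cⱼ

  independent-head : ∀ {k} (T : Vector (Word n) (suc k)) → Independent T → ¬ head T ≈ 𝟎
  independent-head T ind T₀≈𝟎 with ind (true ∷ᵛ 𝟎) single-zero zero
    where
      single-zero : combine T (true ∷ᵛ 𝟎) ≈ 𝟎
      single-zero i = trans (cong (head T i xor_) (combine-𝟎 (tail T) i))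
                            (trans (xor-identityʳ (head T i)) (T₀≈𝟎 i))
  ... | ()

  shear-independent : ∀ {k} (t : Word n) (T : Vector (Word n) k) (b : Word k) →
    Independent (t ∷ᵛ T) → Independent (λ i → T i ⊕ b i · t)
  shear-independent t T b ind μ combination≈𝟎 i =
    ind (dot μ b ∷ᵛ μ) (λ j → trans (sym (combine-shear T b t μ j)) (combination≈𝟎 j)) (suc i)

  spans-removeAt : ∀ {k} (S : Vector (Word n) (suc k)) j {c d : Word (suc k)} {t v : Word n} →
    combine S c ≈ t → c j ≡ true → combine S d ≈ v → Spans (removeAt S j) (v ⊕ d j · t)
  spans-removeAt {k} S j {c} {d} {t} {v} c≈t cⱼ d≈v = removeAt e j , λ i → begin
      combine (removeAt S j) (removeAt e j) i
        ≡⟨ sym (combine-removeAt S e j eⱼ≡false i) ⟩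
      combine S e i
        ≡⟨ combine-⊕ S d (d j · c) i ⟩
      combine S d i xor combine S (d j · c) i
        ≡⟨ cong (combine S d i xor_) (combine-· S (d j) c i) ⟩
      combine S d i xor (d j ∧ combine S c i)
        ≡⟨ cong₂ (λ x y → x xor (d j ∧ y)) (d≈v i) (c≈t i) ⟩
      v i xor (d j ∧ t i)
        ∎
    where
      open ≡-Reasoning
      e : Word (suc k)
      e = d ⊕ d j · c
      eⱼ≡false : e j ≡ false
      eⱼ≡false rewrite cⱼ = cancel (d j)
        where
          cancel : ∀ a → a xor (a ∧ true) ≡ false
          cancel false = refl
          cancel true  = refl

  -- Induction on T: its head t uses some Sⱼ; shearing the
  -- tail by t gives an independent family spanned by S without Sⱼ.
  steinitz : ∀ {k l} (S : Vector (Word n) k) (T : Vector (Word n) l) →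
    Independent T → (∀ i → Spans S (T i)) → l ≤ k
  steinitz {l = zero}  S T ind spans = z≤n
  steinitz {l = suc l} S T ind spans = exchange S spans (nonzero-entry c c≉𝟎)
    where
      c = proj₁ (spans zero)
      c≉𝟎 : ¬ c ≈ 𝟎
      c≉𝟎 c≈𝟎 = independent-head T ind λ i →
        trans (sym (proj₂ (spans zero) i)) (trans (combine-cong S c≈𝟎 i) (combine-𝟎 S i))
      exchange : ∀ {k} (S : Vector (Word n) k) (spans : ∀ i → Spans S (T i)) →
        ∃[ j ] proj₁ (spans zero) j ≡ true → suc l ≤ k
      exchange {suc k} S spans (j , cⱼ) =
        s≤s (steinitz (removeAt S j) (λ i → T (suc i) ⊕ b i · head T)
                      (shear-independent (head T) (tail T) b ind)
                      (λ i → spans-removeAt S j {proj₁ (spans zero)} {proj₁ (spans (suc i))}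
                                 (proj₂ (spans zero)) cⱼ (proj₂ (spans (suc i)))))
        where
          b : Word l
          b i = proj₁ (spans (suc i)) j

  module _ {k : ℕ} {S : Vector (Word n) k} where

    spans-resp : ∀ {v w} → Spans S v → v ≈ w → Spans S w
    spans-resp (c , c≈v) v≈w = c , λ i → trans (c≈v i) (v≈w i)

    spans-𝟎 : Spans S 𝟎
    spans-𝟎 = 𝟎 , combine-𝟎 S

    spans-⊕ : ∀ {v w} → Spans S v → Spans S w → Spans S (v ⊕ w)
    spans-⊕ (c , c≈v) (d , d≈w) = c ⊕ d , λ i →
      trans (combine-⊕ S c d i) (cong₂ _xor_ (c≈v i) (d≈w i))

    spans-· : ∀ b {v} → Spans S v → Spans S (b · v)
    spans-· b (c , c≈v) = b · c , λ i → trans (combine-· S b c i) (cong (b ∧_) (c≈v i))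

    spans-member : ∀ j → Spans S (S j)
    spans-member j = (λ i → eqᵇ i j) , unit-combination S j
      where
        unit-combination : ∀ {k} (S : Vector (Word n) k) j →
          combine S (λ i → eqᵇ i j) ≈ S j
        unit-combination S zero    i = trans (cong (head S i xor_) (combine-𝟎 (tail S) i))
                                             (xor-identityʳ (head S i))
        unit-combination S (suc j) i = unit-combination (tail S) j i

  spans-trans : ∀ {k k′} {S : Vector (Word n) k} {S′ : Vector (Word n) k′} →
    (∀ j → Spans S′ (S j)) → ∀ {v} → Spans S v → Spans S′ v
  spans-trans {S = S} {S′} S⊆⟨S′⟩ (c , c≈v) =
    spans-resp (spans-combination S c S⊆⟨S′⟩) c≈v
    where
      spans-combination : ∀ {k} (S : Vector (Word n) k) c → (∀ j → Spans S′ (S j)) →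
        Spans S′ (combine S c)
      spans-combination {zero}  S c S⊆⟨S′⟩ = spans-𝟎
      spans-combination {suc k} S c S⊆⟨S′⟩ =
        spans-⊕ (spans-· (head c) (S⊆⟨S′⟩ zero))
                (spans-combination (tail S) (tail c) (S⊆⟨S′⟩ ∘ suc))

module _ {A : Set} where

  allᵇ⇒All : ∀ {p : A → Bool} {xs} → allᵇ p xs ≡ true → All (λ x → p x ≡ true) xs
  allᵇ⇒All {p} {[]}     _     = []
  allᵇ⇒All {p} {x ∷ xs} p∧ps with p x in px
  ... | true = px ∷ allᵇ⇒All p∧ps

  All⇒allᵇ : ∀ {p : A → Bool} {xs} → All (λ x → p x ≡ true) xs → allᵇ p xs ≡ true
  All⇒allᵇ []          = refl
  All⇒allᵇ (px ∷ pxs) rewrite px = All⇒allᵇ pxs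

  allᵇ-⊆ : ∀ {p : A → Bool} {xs ys} → xs ⊆ ys → allᵇ p ys ≡ true → allᵇ p xs ≡ true
  allᵇ-⊆ xs⊆ys all-ys = All⇒allᵇ (All-resp-⊆ xs⊆ys (allᵇ⇒All all-ys))

  allᵇ-∈ : ∀ {p : A → Bool} {xs x} → allᵇ p xs ≡ true → x ∈ xs → p x ≡ true
  allᵇ-∈ all-xs = All.lookup (allᵇ⇒All all-xs)

  allᵇ-counterexample : ∀ {p : A → Bool} xs → allᵇ p xs ≡ false →
    ∃[ x ] x ∈ xs × p x ≡ false
  allᵇ-counterexample {p} (x ∷ xs) p∧ps with p x in px
  ... | false = x , here refl , px
  ... | true  = let y , y∈ , py = allᵇ-counterexample xs p∧ps in y , there y∈ , py

  ⊆⇒∈-sublists : ∀ {xs ys : List A} → xs ⊆ ys → xs ∈ sublists ys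
  ⊆⇒∈-sublists []                          = here refl
  ⊆⇒∈-sublists {ys = y ∷ ys} (.y ∷ʳ xs⊆ys) =
    ∈-++⁺ʳ (map (y ∷_) (sublists ys)) (⊆⇒∈-sublists xs⊆ys)
  ⊆⇒∈-sublists (refl ∷ xs⊆ys)              = ∈-++⁺ˡ (∈-map⁺ _ (⊆⇒∈-sublists xs⊆ys))

  ∈-sublists⇒⊆ : ∀ {xs : List A} ys → xs ∈ sublists ys → xs ⊆ ys
  ∈-sublists⇒⊆ []       (here refl) = []
  ∈-sublists⇒⊆ (y ∷ ys) xs∈        with ∈-++⁻ (map (y ∷_) (sublists ys)) xs∈
  ... | inj₂ xs∈′ = y ∷ʳ ∈-sublists⇒⊆ ys xs∈′
  ... | inj₁ xs∈′ with ∈-map⁻ (y ∷_) xs∈′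
  ... | zs , zs∈ , refl = refl ∷ ∈-sublists⇒⊆ ys zs∈

  ∈-++-skip : ∀ {x y : A} xs {ys} → x ∈ xs ++ y ∷ ys → x ≢ y → x ∈ xs ++ ys
  ∈-++-skip []       (here x≡y)  x≢y = ⊥-elim (x≢y x≡y)
  ∈-++-skip []       (there x∈)  x≢y = x∈
  ∈-++-skip (_ ∷ xs) (here x≡z)  x≢y = here x≡z
  ∈-++-skip (_ ∷ xs) (there x∈)  x≢y = there (∈-++-skip xs x∈ x≢y)

  AllPairs-⊆ : ∀ {R : A → A → Set} {xs ys} → xs ⊆ ys → AllPairs R ys → AllPairs R xs
  AllPairs-⊆ []             []         = []
  AllPairs-⊆ (y ∷ʳ xs⊆ys)   (_ ∷ Rys)  = AllPairs-⊆ xs⊆ys Rys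
  AllPairs-⊆ (refl ∷ xs⊆ys) (Ry ∷ Rys) = All-resp-⊆ xs⊆ys Ry ∷ AllPairs-⊆ xs⊆ys Rys

≤-maximum : ∀ {m ms} → m ∈ ms → m ≤ maximum ms
≤-maximum {ms = m ∷ ms} (here refl) = m≤m⊔n m (maximum ms)
≤-maximum {ms = m ∷ ms} (there m′∈) = ≤-trans (≤-maximum m′∈) (m≤n⊔m m (maximum ms))

maximum-≤ : ∀ {b} ms → (∀ {m} → m ∈ ms → m ≤ b) → maximum ms ≤ b
maximum-≤ []       bound = z≤n
maximum-≤ (m ∷ ms) bound = ⊔-lub (bound (here refl)) (maximum-≤ ms (bound ∘ there))

module Matroid {n : ℕ} (G : Graph n) where

  col : Elem n → Word n
  col = column G

  columns : (L : List (Elem n)) → Vector (Word n) (length L)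
  columns L = col ∘ lookup L

  isZeroᵇ-sound : ∀ {w : Word n} → isZeroᵇ w ≡ true → w ≈ 𝟎
  isZeroᵇ-sound {w} zero-test i with w i | allᵇ-∈ zero-test (∈-allFin i)
  ... | false | _ = refl

  isZeroᵇ-complete : ∀ {w : Word n} → w ≈ 𝟎 → isZeroᵇ w ≡ true
  isZeroᵇ-complete w≈𝟎 =
    All⇒allᵇ {xs = allFin n} (All.tabulate λ {i} _ → cong not (w≈𝟎 i))

  select : (L : List (Elem n)) → Word (length L) → List (Elem n)
  select []      c = []
  select (x ∷ L) c with head c
  ... | true  = x ∷ select L (tail c)
  ... | false = select L (tail c)

  colSum-select : ∀ L c → colSum G (select L c) ≈ combine (columns L) c
  colSum-select []      c i = refl
  colSum-select (x ∷ L) c i with head c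
  ... | true  = cong (col x i xor_) (colSum-select L (tail c) i)
  ... | false = colSum-select L (tail c) i

  select-⊆ : ∀ L c → select L c ⊆ L
  select-⊆ []      c = []
  select-⊆ (x ∷ L) c with head c
  ... | true  = refl ∷ select-⊆ L (tail c)
  ... | false = x ∷ʳ select-⊆ L (tail c)

  select-null : ∀ L c → null (select L c) ≡ true → c ≈ 𝟎
  select-null (x ∷ L) c empty with head c in c₀
  select-null (x ∷ L) c ()    | true
  select-null (x ∷ L) c empty | false =
    λ { zero → c₀ ; (suc i) → select-null L (tail c) empty i }

  independent⇒Independent : ∀ L → independentᵇ G L ≡ true → Independent (columns L)
  independent⇒Independent L indep c combination≈𝟎 = select-null L c selection-empty
    where
      L′ = select L c
      sum-zero : isZeroᵇ (colSum G L′) ≡ true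
      sum-zero = isZeroᵇ-complete λ i → trans (colSum-select L c i) (combination≈𝟎 i)
      selection-empty : null L′ ≡ true
      selection-empty with allᵇ-∈ indep (⊆⇒∈-sublists (select-⊆ L c))
      ... | test rewrite sum-zero = trans (sym (∨-identityʳ (null L′))) test

  dependent⇒zero-sum : ∀ L → Dependent G L →
    ∃[ L′ ] L′ ⊆ L × null L′ ≡ false × colSum G L′ ≈ 𝟎
  dependent⇒zero-sum L dep with allᵇ-counterexample (sublists L) dep
  ... | L′ , L′∈ , test with null L′ in nonempty | isZeroᵇ (colSum G L′) in sum-zero
  ... | false | true = L′ , ∈-sublists⇒⊆ L L′∈ , nonempty , isZeroᵇ-sound sum-zero

  zero-sum⇒dependent : ∀ L → null L ≡ false → colSum G L ≈ 𝟎 → Dependent G L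
  zero-sum⇒dependent L nonempty sum≈𝟎 with independentᵇ G L in indep
  ... | false = refl
  ... | true with allᵇ-∈ indep (⊆⇒∈-sublists (⊆-refl {x = L}))
  ... | test rewrite nonempty | isZeroᵇ-complete sum≈𝟎 with test
  ... | ()

  Minimal : List (Elem n) → Set
  Minimal C = ∀ C′ → C′ ⊆ C → ¬ (length C′ ≡ length C) → independentᵇ G C′ ≡ true

  -- Every dependent set contains a circuit: while some proper subset is
  -- dependent, descend to it (the length, bounded by b, strictly decreases).
  minimal-dependent : ∀ b L → length L ≤ b → Dependent G L →
    ∃[ C ] C ⊆ L × Dependent G C × Minimal C
  minimal-dependent b L len≤b dep with any? proper-dependent? (sublists L)
    where
      proper-dependent? : ∀ C′ → Dec (¬ (length C′ ≡ length L) × Dependent G C′)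
      proper-dependent? C′ =
        ¬? (length C′ ℕ.≟ length L) ×-dec (independentᵇ G C′ Bool.≟ false)
  ... | no none = L , ⊆-refl , dep , minimal
    where
      minimal : Minimal L
      minimal C′ C′⊆L proper with independentᵇ G C′ in indep
      ... | true  = refl
      ... | false = ⊥-elim (none (lose (⊆⇒∈-sublists C′⊆L) (proper , indep)))
  ... | yes some with find some
  ... | C′ , C′∈ , proper , dep′ =
    descend (≤-trans (≤∧≢⇒< (length-mono-≤ C′⊆L) proper) len≤b)
    where
      C′⊆L = ∈-sublists⇒⊆ L C′∈
      descend : ∀ {b} → suc (length C′) ≤ b → ∃[ C ] C ⊆ L × Dependent G C × Minimal C
      descend (s≤s len′≤b′) =
        let C , C⊆C′ , depC , minC = minimal-dependent _ C′ len′≤b′ dep′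
        in C , ⊆-trans C⊆C′ C′⊆L , depC , minC

  circuit-within : ∀ L → L ⊆ allElems n → Dependent G L → ∃[ C ] C ⊆ L × IsCircuit G C
  circuit-within L L⊆E dep =
    let C , C⊆L , depC , minC = minimal-dependent (length L) L ≤-refl dep
    in C , C⊆L , ⊆-trans C⊆L L⊆E , depC , minC

  member-spans : ∀ {L x} → x ∈ L → Spans (columns L) (col x)
  member-spans x∈L = spans-resp (spans-member (index x∈L))
                                (λ i → cong (λ y → col y i) (sym (lookup-index x∈L)))

  spans-colSum : ∀ {k} {F : Vector (Word n) k} Q → (∀ {x} → x ∈ Q → Spans F (col x)) →
    Spans F (colSum G Q)
  spans-colSum []      spans = spans-𝟎
  spans-colSum (x ∷ Q) spans = spans-⊕ (spans (here refl)) (spans-colSum Q (spans ∘ there))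

  spans-without : ∀ L₁ {x} L₂ → Spans (columns (L₁ ++ L₂)) (col x) →
    ∀ {v} → Spans (columns (L₁ ++ x ∷ L₂)) v → Spans (columns (L₁ ++ L₂)) v
  spans-without L₁ {x} L₂ x-spanned = spans-trans λ j → member-spanned (∈-lookup j)
    where
      member-spanned : ∀ {y} → y ∈ L₁ ++ x ∷ L₂ → Spans (columns (L₁ ++ L₂)) (col y)
      member-spanned {y} y∈ with ≡-dec Fin._≟_ Fin._≟_ y x
      ... | yes refl = x-spanned
      ... | no  y≢x  = member-spans (∈-++-skip L₁ y∈ y≢x)

  candidate? : (S : ESet n) (T : List (Elem n)) → Dec (Bool.T (allᵇ S T ∧ independentᵇ G T))
  candidate? S T = Bool.T? (allᵇ S T ∧ independentᵇ G T)

  rank-≤ : ∀ {k} (S : ESet n) (F : Vector (Word n) k) →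
    (∀ {x} → S x ≡ true → Spans F (col x)) → rank G S ≤ k
  rank-≤ S F spans = maximum-≤ _ bounded
    where
      bounded : ∀ {m} → m ∈ map length (filter (candidate? S) (sublists (allElems n))) → m ≤ _
      bounded m∈ with ∈-map⁻ length m∈
      ... | T , T∈ , refl
        with Equivalence.to T-∧ (proj₂ (∈-filter⁻ (candidate? S) {xs = sublists (allElems n)} T∈))
      ... | T⊆S , indep =
        steinitz F (columns T) (independent⇒Independent T (Equivalence.to T-≡ indep))
                 (λ i → spans (allᵇ-∈ {xs = T} (Equivalence.to T-≡ T⊆S) (∈-lookup i)))

  ≤-rank : ∀ (S : ESet n) T → T ⊆ allElems n → T ⊆ₛ S → independentᵇ G T ≡ true →
    length T ≤ rank G S
  ≤-rank S T T⊆E T⊆S indep =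
    ≤-maximum (∈-map⁺ length (∈-filter⁺ (candidate? S) (⊆⇒∈-sublists T⊆E)
      (Equivalence.from T-∧ (Equivalence.from T-≡ T⊆S , Equivalence.from T-≡ indep))))

eqᵇ-refl : ∀ {k} (a : Fin k) → eqᵇ a a ≡ true
eqᵇ-refl zero    = refl
eqᵇ-refl (suc a) = eqᵇ-refl a

eqᵇ-sound : ∀ {k} {a b : Fin k} → eqᵇ a b ≡ true → a ≡ b
eqᵇ-sound {a = zero}  {zero}  _  = refl
eqᵇ-sound {a = suc a} {suc b} eq = cong suc (eqᵇ-sound eq)

eqᵇ-≢ : ∀ {k} {a b : Fin k} → a ≢ b → eqᵇ a b ≡ false
eqᵇ-≢ {a = a} {b} a≢b with eqᵇ a b in eq
... | false = refl
... | true  = ⊥-elim (a≢b (eqᵇ-sound eq))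

module _ {n : ℕ} where

  VertexDistinct : List (Elem n) → Set
  VertexDistinct = AllPairs (λ x y → proj₁ x ≢ proj₁ y)

  -- Such a list lies in a transversal: choose, for every vertex, the
  -- element of the list over it (and φ where there is none).
  choice : List (Elem n) → Fin n → Fin 3
  choice []            v = zero
  choice ((w , k) ∷ L) v = if eqᵇ v w then k else choice L v

  vertexDistinct⇒transverse : ∀ {L} → VertexDistinct L → ∃[ t ] L ⊆ₛ transversal t
  vertexDistinct⇒transverse {L} distinct = choice L , All⇒allᵇ (chosen distinct)
    where
      chosen : ∀ {L} → VertexDistinct L → All (λ x → transversal (choice L) x ≡ true) L
      chosen []                                  = []
      chosen {(w , k) ∷ L} (w-fresh ∷ distinct) =
        head-chosen
          ∷ All.zipWith (λ (w≢u , chosen-x) → keep w≢u chosen-x) (w-fresh , chosen distinct)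
        where
          head-chosen : eqᵇ (if eqᵇ w w then k else choice L w) k ≡ true
          head-chosen rewrite eqᵇ-refl w = eqᵇ-refl k
          keep : ∀ {x} → w ≢ proj₁ x → transversal (choice L) x ≡ true →
            transversal (choice ((w , k) ∷ L)) x ≡ true
          keep {u , _} w≢u chosen-x rewrite eqᵇ-≢ (w≢u ∘ sym) = chosen-x

  -- Conversely a duplicate-free list inside a transversal is vertex-distinct,
  -- since the transversal determines the element over each vertex.
  transverse⇒vertexDistinct : ∀ {L t} → L ⊆ allElems n → L ⊆ₛ transversal t →
    VertexDistinct L
  transverse⇒vertexDistinct {t = t} L⊆E L⊆t =
    distinct (AllPairs-⊆ L⊆E (cartesianProduct⁺ (allFin⁺ n) (allFin⁺ 3))) (allᵇ⇒All L⊆t)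
    where
      different-vertex : ∀ {x y} → x ≢ y → transversal t x ≡ true → transversal t y ≡ true →
        proj₁ x ≢ proj₁ y
      different-vertex {v , k} {.v , k′} x≢y tx ty refl =
        x≢y (cong (v ,_) (trans (sym (eqᵇ-sound {a = t v} tx)) (eqᵇ-sound {a = t v} ty)))
      distinct : ∀ {L} → Unique L → All (λ x → transversal t x ≡ true) L → VertexDistinct L
      distinct []                 []        = []
      distinct (x-fresh ∷ unique) (tx ∷ tL) =
        All.zipWith (λ (x≢y , ty) → different-vertex x≢y tx ty) (x-fresh , tL)
          ∷ distinct unique tL

block : ∀ {n} → Bool → Fin n → List (Elem n) → List (Elem n)
block true  v rest = φ v ∷ χ v ∷ rest
block false v rest = rest

basisOver : ∀ {n m} → Subset n → (Fin m → Fin n) → List (Elem n)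
basisOver {m = zero}  X h = []
basisOver {m = suc m} X h = block (Vec.lookup X (h zero)) (h zero) (basisOver X (h ∘ suc))

basis : ∀ {n} → Subset n → List (Elem n)
basis X = basisOver X id

length-shift : ∀ {n m} b (X : Subset n) (h : Fin m → Fin n) →
  length (basisOver (b Vec.∷ X) (suc ∘ h)) ≡ length (basisOver X h)
length-shift {m = zero}  b X h = refl
length-shift {m = suc m} b X h with Vec.lookup X (h zero)
... | true  = cong (λ m → suc (suc m)) (length-shift b X (h ∘ suc))
... | false = length-shift b X (h ∘ suc)

length-basis : ∀ {n} (X : Subset n) → length (basis X) ≡ 2 * ∣ X ∣
length-basis Vec.[]          = refl
length-basis (true  Vec.∷ X) =
  trans (cong (λ m → suc (suc m)) (trans (length-shift true X id) (length-basis X)))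
        (sym (*-suc 2 ∣ X ∣))
length-basis (false Vec.∷ X) = trans (length-shift false X id) (length-basis X)

module _ {n : ℕ} (X : Subset n) where

  basisOver-⊆ : ∀ {m} (h : Fin m → Fin n) →
    basisOver X h ⊆ cartesianProduct (tabulate h) (allFin 3)
  basisOver-⊆ {zero}  h = []
  basisOver-⊆ {suc m} h with Vec.lookup X (h zero)
  ... | true  = refl ∷ refl ∷ _ ∷ʳ basisOver-⊆ (h ∘ suc)
  ... | false = _ ∷ʳ _ ∷ʳ _ ∷ʳ basisOver-⊆ (h ∘ suc)

  basisOver-τ : ∀ {m} (h : Fin m → Fin n) → basisOver X h ⊆ₛ τ X
  basisOver-τ {zero}  h = refl
  basisOver-τ {suc m} h with Vec.lookup X (h zero) in h₀∈X
  ... | true  rewrite h₀∈X = basisOver-τ (h ∘ suc)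
  ... | false = basisOver-τ (h ∘ suc)

  basisOver-∋ : ∀ {m} (h : Fin m → Fin n) i → Vec.lookup X (h i) ≡ true →
    φ (h i) ∈ basisOver X h × χ (h i) ∈ basisOver X h
  basisOver-∋ h zero    hᵢ∈X rewrite hᵢ∈X = here refl , there (here refl)
  basisOver-∋ h (suc i) hᵢ∈X with Vec.lookup X (h zero) | basisOver-∋ (h ∘ suc) i hᵢ∈X
  ... | true  | φ∈ , χ∈ = there (there φ∈) , there (there χ∈)
  ... | false | φ∈ , χ∈ = φ∈ , χ∈

  basis-∋ : ∀ {v} → Vec.lookup X v ≡ true → φ v ∈ basis X × χ v ∈ basis X
  basis-∋ {v} = basisOver-∋ id v

  merge : ∀ {m} (h : Fin m → Fin n) {L} → L ⊆ basisOver X h → List (Elem n)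
  merge {zero}  h [] = []
  merge {suc m} h L⊆ with Vec.lookup X (h zero)
  merge {suc m} h L⊆                 | false = merge (h ∘ suc) L⊆
  merge {suc m} h (_ ∷ʳ _ ∷ʳ L⊆)     | true  = merge (h ∘ suc) L⊆
  merge {suc m} h (refl ∷ _ ∷ʳ L⊆)   | true  = φ (h zero) ∷ merge (h ∘ suc) L⊆
  merge {suc m} h (_ ∷ʳ refl ∷ L⊆)   | true  = χ (h zero) ∷ merge (h ∘ suc) L⊆
  merge {suc m} h (refl ∷ refl ∷ L⊆) | true  = ψ (h zero) ∷ merge (h ∘ suc) L⊆

  merge-⊆ : ∀ {m} (h : Fin m → Fin n) {L} (L⊆ : L ⊆ basisOver X h) →
    merge h L⊆ ⊆ cartesianProduct (tabulate h) (allFin 3)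
  merge-⊆ {zero}  h [] = []
  merge-⊆ {suc m} h L⊆ with Vec.lookup X (h zero)
  merge-⊆ {suc m} h L⊆                 | false = _ ∷ʳ _ ∷ʳ _ ∷ʳ merge-⊆ (h ∘ suc) L⊆
  merge-⊆ {suc m} h (_ ∷ʳ _ ∷ʳ L⊆)     | true  = _ ∷ʳ _ ∷ʳ _ ∷ʳ merge-⊆ (h ∘ suc) L⊆
  merge-⊆ {suc m} h (refl ∷ _ ∷ʳ L⊆)   | true  = refl ∷ _ ∷ʳ _ ∷ʳ merge-⊆ (h ∘ suc) L⊆
  merge-⊆ {suc m} h (_ ∷ʳ refl ∷ L⊆)   | true  = _ ∷ʳ refl ∷ _ ∷ʳ merge-⊆ (h ∘ suc) L⊆
  merge-⊆ {suc m} h (refl ∷ refl ∷ L⊆) | true  = _ ∷ʳ _ ∷ʳ refl ∷ merge-⊆ (h ∘ suc) L⊆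

  merge-τ : ∀ {m} (h : Fin m → Fin n) {L} (L⊆ : L ⊆ basisOver X h) → merge h L⊆ ⊆ₛ τ X
  merge-τ {zero}  h [] = refl
  merge-τ {suc m} h L⊆ with Vec.lookup X (h zero) in h₀∈X
  merge-τ {suc m} h L⊆                 | false = merge-τ (h ∘ suc) L⊆
  merge-τ {suc m} h (_ ∷ʳ _ ∷ʳ L⊆)     | true  = merge-τ (h ∘ suc) L⊆
  merge-τ {suc m} h (refl ∷ _ ∷ʳ L⊆)   | true  rewrite h₀∈X = merge-τ (h ∘ suc) L⊆
  merge-τ {suc m} h (_ ∷ʳ refl ∷ L⊆)   | true  rewrite h₀∈X = merge-τ (h ∘ suc) L⊆
  merge-τ {suc m} h (refl ∷ refl ∷ L⊆) | true  rewrite h₀∈X = merge-τ (h ∘ suc) L⊆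

  merge-nonempty : ∀ {m} (h : Fin m → Fin n) {L} (L⊆ : L ⊆ basisOver X h) →
    null L ≡ false → null (merge h L⊆) ≡ false
  merge-nonempty {zero}  h [] ()
  merge-nonempty {suc m} h L⊆ nonempty with Vec.lookup X (h zero)
  merge-nonempty {suc m} h L⊆                 nonempty | false =
    merge-nonempty (h ∘ suc) L⊆ nonempty
  merge-nonempty {suc m} h (_ ∷ʳ _ ∷ʳ L⊆)     nonempty | true  =
    merge-nonempty (h ∘ suc) L⊆ nonempty
  merge-nonempty {suc m} h (refl ∷ _ ∷ʳ L⊆)   nonempty | true  = refl
  merge-nonempty {suc m} h (_ ∷ʳ refl ∷ L⊆)   nonempty | true  = refl
  merge-nonempty {suc m} h (refl ∷ refl ∷ L⊆) nonempty | true  = refl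

  merge-fresh : ∀ {m} (h : Fin (suc m) → Fin n) → Injective _≡_ _≡_ h →
    ∀ {L} (L⊆ : L ⊆ basisOver X (h ∘ suc)) →
    All (λ x → h zero ≢ proj₁ x) (merge (h ∘ suc) L⊆)
  merge-fresh h inj L⊆ = All.tabulate λ x∈ h₀≡x₁ →
    let x∈E = Any-resp-⊆ (merge-⊆ (h ∘ suc) L⊆) x∈
        x₁∈ = proj₁ (∈-cartesianProduct⁻ (tabulate (h ∘ suc)) (allFin 3) x∈E)
        i , x₁≡hᵢ = ∈-tabulate⁻ {f = h ∘ suc} x₁∈
    in 0≢1+n (inj (trans h₀≡x₁ x₁≡hᵢ))

  merge-vertexDistinct : ∀ {m} (h : Fin m → Fin n) → Injective _≡_ _≡_ h →
    ∀ {L} (L⊆ : L ⊆ basisOver X h) → VertexDistinct (merge h L⊆)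
  merge-vertexDistinct {zero}  h inj [] = []
  merge-vertexDistinct {suc m} h inj L⊆ with Vec.lookup X (h zero)
  ... | false = merge-vertexDistinct (h ∘ suc) (suc-injective ∘ inj) L⊆
  merge-vertexDistinct {suc m} h inj (_ ∷ʳ _ ∷ʳ L⊆)     | true =
    merge-vertexDistinct (h ∘ suc) (suc-injective ∘ inj) L⊆
  merge-vertexDistinct {suc m} h inj (refl ∷ _ ∷ʳ L⊆)   | true =
    merge-fresh h inj L⊆ ∷ merge-vertexDistinct (h ∘ suc) (suc-injective ∘ inj) L⊆
  merge-vertexDistinct {suc m} h inj (_ ∷ʳ refl ∷ L⊆)   | true =
    merge-fresh h inj L⊆ ∷ merge-vertexDistinct (h ∘ suc) (suc-injective ∘ inj) L⊆
  merge-vertexDistinct {suc m} h inj (refl ∷ refl ∷ L⊆) | true =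
    merge-fresh h inj L⊆ ∷ merge-vertexDistinct (h ∘ suc) (suc-injective ∘ inj) L⊆

module Rank {n : ℕ} (G : Graph n) (X : Subset n) where

  open Matroid G

  W : List (Elem n)
  W = basis X

  TransverseCircuitIn : Set
  TransverseCircuitIn = Σ (List (Elem n)) λ C → IsTransverseCircuit G C × C ⊆ₛ τ X

  -- ψ(v) = φ(v) + χ(v), so a family spanning φ(v) and χ(v) spans all of τ(v).
  spans-triple : ∀ {k} {F : Vector (Word n) k} v →
    Spans F (col (φ v)) → Spans F (col (χ v)) → ∀ t → Spans F (col (v , t))
  spans-triple v φ-spanned χ-spanned zero             = φ-spanned
  spans-triple v φ-spanned χ-spanned (suc zero)       = χ-spanned
  spans-triple v φ-spanned χ-spanned (suc (suc zero)) =
    spans-resp (spans-⊕ χ-spanned φ-spanned) λ i → refl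

  -- Merging keeps the column sum, again because col ψ(v) = col φ(v) + col χ(v).
  colSum-merge : ∀ {m} (h : Fin m → Fin n) {L} (L⊆ : L ⊆ basisOver X h) →
    colSum G (merge X h L⊆) ≈ colSum G L
  colSum-merge {zero}  h [] i = refl
  colSum-merge {suc m} h L⊆ i with Vec.lookup X (h zero)
  colSum-merge {suc m} h L⊆                 i | false = colSum-merge (h ∘ suc) L⊆ i
  colSum-merge {suc m} h (_ ∷ʳ _ ∷ʳ L⊆)     i | true  = colSum-merge (h ∘ suc) L⊆ i
  colSum-merge {suc m} h (refl ∷ _ ∷ʳ L⊆)   i | true  =
    cong (col (φ (h zero)) i xor_) (colSum-merge (h ∘ suc) L⊆ i)
  colSum-merge {suc m} h (_ ∷ʳ refl ∷ L⊆)   i | true  =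
    cong (col (χ (h zero)) i xor_) (colSum-merge (h ∘ suc) L⊆ i)
  colSum-merge {suc m} h (refl ∷ refl ∷ L⊆) i | true  =
    trans (cong (col (ψ (h zero)) i xor_) (colSum-merge (h ∘ suc) L⊆ i))
          (split-ψ (adj G i (h zero)) (eqᵇ i (h zero)) _)
    where
      split-ψ : ∀ a e r → (a xor e) xor r ≡ e xor (a xor r)
      split-ψ = solve-∀ 𝔽₂

  basis-spans : ∀ {x} → τ X x ≡ true → Spans (columns W) (col x)
  basis-spans {v , t} v∈X =
    let φ∈ , χ∈ = basis-∋ X v∈X in spans-triple v (member-spans φ∈) (member-spans χ∈) t

  rank≤2∣X∣ : rank G (τ X) ≤ 2 * ∣ X ∣
  rank≤2∣X∣ = subst (rank G (τ X) ≤_) (length-basis X)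
                    (rank-≤ (τ X) (columns W) (λ {x} → basis-spans {x}))

  dependent-basis⇒transverse-circuit : Dependent G W → TransverseCircuitIn
  dependent-basis⇒transverse-circuit dep =
    let L , L⊆W , nonempty , sum≈𝟎 = dependent⇒zero-sum W dep
        D = merge X id L⊆W
        D-dependent = zero-sum⇒dependent D (merge-nonempty X id L⊆W nonempty)
                        λ i → trans (colSum-merge id L⊆W i) (sum≈𝟎 i)
        C , C⊆D , circuit = circuit-within D (merge-⊆ X id L⊆W) D-dependent
        t , D⊆t = vertexDistinct⇒transverse (merge-vertexDistinct X id id L⊆W)
    in C , (circuit , t , allᵇ-⊆ C⊆D D⊆t) , allᵇ-⊆ C⊆D (merge-τ X id L⊆W)

  2∣X∣≤rank : ¬ TransverseCircuitIn → 2 * ∣ X ∣ ≤ rank G (τ X)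
  2∣X∣≤rank none with independentᵇ G W in indep
  ... | true  = subst (_≤ rank G (τ X)) (length-basis X)
                      (≤-rank (τ X) W (basisOver-⊆ X id) (basisOver-τ X id) indep)
  ... | false = ⊥-elim (none (dependent-basis⇒transverse-circuit indep))

  -- For c = (v , k): the element of W to be exchanged against c, and the
  -- other element of W over v.
  pivot partner : Elem n → Elem n
  pivot   (v , zero)             = φ v
  pivot   (v , suc zero)         = χ v
  pivot   (v , suc (suc zero))   = φ v
  partner (v , zero)             = χ v
  partner (v , suc zero)         = φ v
  partner (v , suc (suc zero))   = χ v

  pivot-vertex : ∀ c → proj₁ (pivot c) ≡ proj₁ c
  pivot-vertex (v , zero)           = refl
  pivot-vertex (v , suc zero)       = refl
  pivot-vertex (v , suc (suc zero)) = refl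

  partner≢pivot : ∀ c → partner c ≢ pivot c
  partner≢pivot (v , zero)           ()
  partner≢pivot (v , suc zero)       ()
  partner≢pivot (v , suc (suc zero)) ()

  pivot-partner-∈ : ∀ c → Vec.lookup X (proj₁ c) ≡ true → pivot c ∈ W × partner c ∈ W
  pivot-partner-∈ (v , zero)           v∈X = basis-∋ X v∈X
  pivot-partner-∈ (v , suc zero)       v∈X = let φ∈ , χ∈ = basis-∋ X v∈X in χ∈ , φ∈
  pivot-partner-∈ (v , suc (suc zero)) v∈X = basis-∋ X v∈X

  pivot-spanned : ∀ {k} {F : Vector (Word n) k} c →
    Spans F (col c) → Spans F (col (partner c)) → Spans F (col (pivot c))
  pivot-spanned (v , zero)           c-spanned _ = c-spanned
  pivot-spanned (v , suc zero)       c-spanned _ = c-spanned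
  pivot-spanned (v , suc (suc zero)) c-spanned partner-spanned =
    spans-resp (spans-⊕ c-spanned partner-spanned) λ i → cancel (adj G i v) (eqᵇ i v)
    where
      cancel : ∀ a e → (a xor e) xor a ≡ e
      cancel = solve-∀ 𝔽₂

  -- A zero-sum vertex-distinct list c₀ ∷ Q inside τ(X) makes pivot c₀
  -- redundant in W: col c₀ = Σ col Q is spanned by the elements of W over
  -- the other vertices, and col (pivot c₀) by col c₀ and col (partner c₀).
  -- So W without pivot c₀ spans τ(X), and rank τ(X) < 2|X|.
  relation⇒rank< : ∀ c₀ Q → colSum G (c₀ ∷ Q) ≈ 𝟎 → VertexDistinct (c₀ ∷ Q) → (c₀ ∷ Q) ⊆ₛ τ X →
    suc (rank G (τ X)) ≤ 2 * ∣ X ∣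
  relation⇒rank< c₀ Q sum≈𝟎 (c₀-fresh ∷ _) c₀Q⊆τ = begin
      suc (rank G (τ X))           ≤⟨ s≤s (rank-≤ (τ X) (columns S′) (λ {x} → spans-τ {x})) ⟩
      suc (length S′)              ≡⟨ sym (length-++-sucʳ W₁ (pivot c₀) W₂) ⟩
      length (W₁ ++ pivot c₀ ∷ W₂) ≡⟨ cong length (sym W≡) ⟩
      length W                     ≡⟨ length-basis X ⟩
      2 * ∣ X ∣                    ∎
    where
      open ≤-Reasoning
      c₀-in-W = pivot-partner-∈ c₀ (allᵇ-∈ {xs = c₀ ∷ Q} c₀Q⊆τ (here refl))
      split = ∈-∃++ (proj₁ c₀-in-W)
      W₁ = proj₁ split
      W₂ = proj₁ (proj₂ split)
      W≡ = proj₂ (proj₂ split)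
      S′ = W₁ ++ W₂

      remains : ∀ {y} → y ∈ W → y ≢ pivot c₀ → Spans (columns S′) (col y)
      remains y∈ y≢pivot = member-spans (∈-++-skip W₁ (subst (_ ∈_) W≡ y∈) y≢pivot)

      Q-spanned : ∀ {q} → q ∈ Q → Spans (columns S′) (col q)
      Q-spanned {w , t} q∈ = spans-triple w (remains (proj₁ w-block) off-pivot)
                                            (remains (proj₂ w-block) off-pivot) t
        where
          w-block = basis-∋ X (allᵇ-∈ {xs = c₀ ∷ Q} c₀Q⊆τ (there q∈))
          off-pivot : ∀ {t′} → (w , t′) ≢ pivot c₀
          off-pivot eq =
            All.lookup c₀-fresh q∈ (trans (sym (pivot-vertex c₀)) (sym (cong proj₁ eq)))

      c₀-spanned : Spans (columns S′) (col c₀)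
      c₀-spanned = spans-resp (spans-colSum Q Q-spanned) λ i → xor-cancel (sum≈𝟎 i)
        where
          xor-cancel : ∀ {a b} → a xor b ≡ false → b ≡ a
          xor-cancel {false} {false} _ = refl
          xor-cancel {true}  {true}  _ = refl

      pivot-redundant : Spans (columns S′) (col (pivot c₀))
      pivot-redundant = pivot-spanned c₀ c₀-spanned (remains (proj₂ c₀-in-W) (partner≢pivot c₀))

      spans-τ : ∀ {x} → τ X x ≡ true → Spans (columns S′) (col x)
      spans-τ {x} x∈τ = spans-without W₁ W₂ pivot-redundant
                          (subst (λ L → Spans (columns L) (col x)) W≡ (basis-spans {x} x∈τ))

  -- A transverse circuit in τ(X) is dependent, so it contains a zero-sum
  -- list, which is vertex-distinct because it lies in a transversal.
  transverse-circuit⇒rank< : TransverseCircuitIn → suc (rank G (τ X)) ≤ 2 * ∣ X ∣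
  transverse-circuit⇒rank< (C , ((C⊆E , C-dependent , _) , t , C⊆t) , C⊆τ)
    with dependent⇒zero-sum C C-dependent
  ... | []     , _   , () , _
  ... | c₀ ∷ Q , D⊆C , _  , sum≈𝟎 =
    relation⇒rank< c₀ Q sum≈𝟎 (transverse⇒vertexDistinct {t = t} (⊆-trans D⊆C C⊆E) (allᵇ-⊆ D⊆C C⊆t))
                   (allᵇ-⊆ D⊆C C⊆τ)

lemma34 : ∀ {n} (G : Graph n) (X : Subset n) →
    ((2 * ∣ X ∣ ≤ rank G (τ X)) ⇔ (rank G (τ X) ≡ 2 * ∣ X ∣)) ×
    ((rank G (τ X) ≡ 2 * ∣ X ∣) ⇔
      (¬ (Σ (List (Elem n)) λ C → IsTransverseCircuit G C × C ⊆ₛ τ X)))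
lemma34 G X =
  mk⇔ (≤-antisym rank≤2∣X∣) (≤-reflexive ∘ sym) ,
  mk⇔ (λ rank≡2∣X∣ circuit → <-irrefl rank≡2∣X∣ (transverse-circuit⇒rank< circuit))
      (λ no-circuit → ≤-antisym rank≤2∣X∣ (2∣X∣≤rank no-circuit))
  where
    open Rank G X
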